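{- Let $T$ and $T^*$ be rooted phylogenetic trees with the same leaf set $L$ such that $T^*$ is a refinement of $T$. Let $u^*v^*\in E(T^*)$ be an edge with $v^*\prec_{T^*}u^*$. Then there is a unique vertex $w\in V(T)$ such that $L(T(w))$ is inclusion-minimal in $\mathcal{H}(T)$ with the property $L(T^*(v^*))\subsetneq L(T(w))$. Moreover, for all $x,y\in L$, if $\operatorname{lca}_{T^*}(x,y)=u^*$, then $\operatorname{lca}_T(x,y)=w$.
   Context: A rooted tree $T$ is phylogenetic if every inner (non-leaf) vertex has at least two children. $x\preceq_T y$ means $y$ lies on the path from $x$ to the root; $x\prec_T y$ means $x\preceq_T y$ and $x\ne y$. $T(u)$ is the subtree of $T$ rooted at $u$ and $L(T(u))$ its leaf set. $\mathcal{H}(T)=\{L(T(u))\mid u\in V(T)\}$ is the hierarchy (cluster system) of $T$. $\operatorname{lca}_T(x,y)$ is the $\preceq_T$-minimal vertex that is an ancestor of both $x$ and $y$. For phylogenetic trees $T,T^*$ with $L(T)=L(T^*)$, $T^*$ is a refinement of $T$ iff $\mathcal{H}(T)\subseteq\mathcal{H}(T^*)$ (equivalently, $T$ is obtained from $T^*$ by contracting a subset of inner edges). -}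

module Defs where

open import Data.Nat using (ℕ)
open import Data.Fin using (Fin)
open import Data.Product using (Σ; ∃; _×_; _,_)
open import Relation.Binary.PropositionalEquality using (_≡_; _≢_)
open import Relation.Nullary using (¬_)

-- A rooted tree on the vertex set Fin n, given by a root and a parent map.
-- The value of 'parent' at the root is irrelevant (never used).
record RawTree (n : ℕ) : Set where
  field
    root   : Fin n
    parent : Fin n → Fin n
open RawTree public

-- Anc R v w  :  v ⪯ w, i.e. w lies on the path from v to the root.
data Anc {n : ℕ} (R : RawTree n) : Fin n → Fin n → Set where
  here : ∀ {v} → Anc R v v
  up   : ∀ {v w} → v ≢ root R → Anc R (parent R v) w → Anc R v w

Child : ∀ {n} → RawTree n → Fin n → Fin n → Set
Child R v c = (c ≢ root R) × (parent R c ≡ v)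

IsLeafVertex : ∀ {n} → RawTree n → Fin n → Set
IsLeafVertex R v = ∀ c → ¬ Child R v c

record PhyloTree (X : Set) (n : ℕ) : Set where
  field
    raw        : RawTree n
    -- every vertex reaches the root (makes the parent graph a rooted tree)
    toRoot     : ∀ v → Anc raw v (root raw)
    -- phylogenetic: every inner vertex has at least two children
    phylo      : ∀ v c → Child raw v c → ∃ λ c′ → Child raw v c′ × c′ ≢ c
    leaf       : X → Fin n
    leaf-inj   : ∀ x y → leaf x ≡ leaf y → x ≡ y
    leaf-leaf  : ∀ x → IsLeafVertex raw (leaf x)
    leaf-onto  : ∀ v → IsLeafVertex raw v → ∃ λ x → leaf x ≡ v
open PhyloTree public

_⪯[_]_ : ∀ {X n} → Fin n → PhyloTree X n → Fin n → Set
v ⪯[ T ] w = Anc (raw T) v w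

IsEdge : ∀ {X n} → PhyloTree X n → Fin n → Fin n → Set
IsEdge T u v = Child (raw T) u v

-- clusters L(T(u)) as predicates on the leaf set X
Cluster : ∀ {X n} → PhyloTree X n → Fin n → X → Set
Cluster T u x = leaf T x ⪯[ T ] u

_⊆_ : ∀ {X : Set} → (X → Set) → (X → Set) → Set
A ⊆ B = ∀ x → A x → B x

_≐_ : ∀ {X : Set} → (X → Set) → (X → Set) → Set
A ≐ B = (A ⊆ B) × (B ⊆ A)

_⊊_ : ∀ {X : Set} → (X → Set) → (X → Set) → Set
A ⊊ B = (A ⊆ B) × ∃ λ x → B x × ¬ A x

InHierarchy : ∀ {X n} → (X → Set) → PhyloTree X n → Set
InHierarchy A T = ∃ λ u → Cluster T u ≐ A

Refines : ∀ {X n m} → PhyloTree X m → PhyloTree X n → Set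
Refines T* T = ∀ u → InHierarchy (Cluster T u) T*

IsLca : ∀ {X n} → PhyloTree X n → Fin n → Fin n → Fin n → Set
IsLca T a b w = (a ⪯[ T ] w) × (b ⪯[ T ] w)
              × (∀ z → a ⪯[ T ] z → b ⪯[ T ] z → w ⪯[ T ] z)

MinimalAbove : ∀ {X n} → PhyloTree X n → (X → Set) → Fin n → Set
MinimalAbove T A w =
  (A ⊊ Cluster T w)
  × (∀ u → A ⊊ Cluster T u → Cluster T u ⊆ Cluster T w → Cluster T u ≐ Cluster T w)

{-# OPTIONS --safe #-}
-- Since 𝓗(T) ⊆ 𝓗(T*), every vertex z of T has a copy z* in T* with the same
-- cluster, and in a tree clusters are ordered exactly as their vertices.
-- Hence L(T*(v*)) ⊊ L(T(z)) iff v* ≺ z* in T*, iff u* ⪯ z*.  These z all lie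
-- above a leaf of T*(v*) in T, so they form a chain with a least element w; it
-- is the unique minimal one, and it is the least upper bound in T of any two
-- leaves whose lca in T* is u*.
module Submission where

open import Defs
open import Data.Nat using (ℕ; suc; _+_; _≤_; _<_; s≤s)
open import Data.Nat.Properties using (<-irrefl; <⇒≱; m≤n+m; n<1+n)
open import Data.Fin using (Fin; _≟_)
open import Data.List using (filter; allFin)
open import Data.List.Extrema.Nat using (argmax; argmax-all; f[xs]≤f[argmax])
open import Data.List.Membership.Propositional using (_∈_)
open import Data.List.Membership.Propositional.Properties using (∈-filter⁺; ∈-allFin)
open import Data.List.Relation.Unary.All using (lookup)
open import Data.List.Relation.Unary.All.Properties using (all-filter)
open import Data.Product using (∃; _×_; _,_; proj₁; proj₂; swap)
open import Data.Sum using (_⊎_; inj₁; inj₂)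
open import Data.Empty using (⊥-elim)
open import Relation.Nullary using (¬_; Dec; yes; no)
open import Relation.Nullary.Decidable using (_×-dec_; ¬?)
open import Relation.Unary using (Decidable)
open import Relation.Binary.PropositionalEquality
  using (_≡_; _≢_; refl; sym; trans; subst; cong)

⊊-respʳ-≐ : {X : Set} {A B C : X → Set} → A ⊊ B → B ≐ C → A ⊊ C
⊊-respʳ-≐ (A⊆B , x , Bx , ¬Ax) (B⊆C , _) = (λ y Ay → B⊆C y (A⊆B y Ay)) , x , B⊆C x Bx , ¬Ax

module Tree {X : Set} {n : ℕ} (T : PhyloTree X n) where

  infix 4 _⪯_ _≺_ _⪯?_

  _⪯_ : Fin n → Fin n → Set
  _⪯_ = Anc (raw T)

  _≺_ : Fin n → Fin n → Set
  v ≺ w = v ⪯ w × v ≢ w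

  ⪯-trans : ∀ {u v w} → u ⪯ v → v ⪯ w → u ⪯ w
  ⪯-trans here     q = q
  ⪯-trans (up h p) q = up h (⪯-trans p q)

  pathLength : ∀ {v w} → v ⪯ w → ℕ
  pathLength here     = 0
  pathLength (up _ p) = suc (pathLength p)

  pathLength-toRoot : ∀ {v} (p q : v ⪯ root (raw T)) → pathLength p ≡ pathLength q
  pathLength-toRoot here     here     = refl
  pathLength-toRoot here     (up h _) = ⊥-elim (h refl)
  pathLength-toRoot (up h _) here     = ⊥-elim (h refl)
  pathLength-toRoot (up _ p) (up _ q) = cong suc (pathLength-toRoot p q)

  depth : Fin n → ℕ
  depth v = pathLength (toRoot T v)

  depth-split : ∀ {v w} (p : v ⪯ w) → depth v ≡ pathLength p + depth w
  depth-split here = refl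
  depth-split {v} (up h p) =
    trans (pathLength-toRoot (toRoot T v) (up h (toRoot T (parent (raw T) v))))
          (cong suc (depth-split p))

  ≺⇒depth> : ∀ {v w} → v ≺ w → depth w < depth v
  ≺⇒depth> (here , v≢w) = ⊥-elim (v≢w refl)
  ≺⇒depth> {w = w} (up h p , _) =
    subst (depth w <_) (sym (depth-split (up h p))) (s≤s (m≤n+m (depth w) (pathLength p)))

  ⪯⇒depth≥ : ∀ {v w} → v ⪯ w → depth w ≤ depth v
  ⪯⇒depth≥ {w = w} p = subst (depth w ≤_) (sym (depth-split p)) (m≤n+m (depth w) (pathLength p))

  ⪯-antisym : ∀ {v w} → v ⪯ w → w ⪯ v → v ≡ w
  ⪯-antisym {v} {w} v⪯w w⪯v with v ≟ w
  ... | yes v≡w = v≡w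
  ... | no  v≢w = ⊥-elim (<⇒≱ (≺⇒depth> (v⪯w , v≢w)) (⪯⇒depth≥ w⪯v))

  ⪯-total-above : ∀ {v a b} → v ⪯ a → v ⪯ b → a ⪯ b ⊎ b ⪯ a
  ⪯-total-above here     q        = inj₁ q
  ⪯-total-above (up h p) here     = inj₂ (up h p)
  ⪯-total-above (up _ p) (up _ q) = ⪯-total-above p q

  child⇒≺ : ∀ {v c} → Child (raw T) v c → c ≺ v
  child⇒≺ {c = c} (c≢root , refl) = c⪯v , c≢v
    where
      c⪯v : c ⪯ parent (raw T) c
      c⪯v = up c≢root here
      c≢v : c ≢ parent (raw T) c
      c≢v c≡v = <-irrefl (cong depth (sym c≡v)) (subst (depth (parent (raw T) c) <_) (sym (depth-split c⪯v)) (n<1+n _))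

  _⪯?_ : ∀ v w → Dec (v ⪯ w)
  v ⪯? w = go v (toRoot T v)
    where
      go : ∀ v → v ⪯ root (raw T) → Dec (v ⪯ w)
      go v p with v ≟ w
      ... | yes refl = yes here
      go v here     | no v≢w = no λ { here → v≢w refl ; (up h _) → h refl }
      go v (up h p) | no v≢w with go (parent (raw T) v) p
      ... | yes q = yes (up h q)
      ... | no ¬q = no λ { here → v≢w refl ; (up _ q) → ¬q q }

  deepestBelow : Fin n → Fin n
  deepestBelow u = argmax depth u (filter (_⪯? u) (allFin n))

  deepestBelow-⪯ : ∀ u → deepestBelow u ⪯ u
  deepestBelow-⪯ u = argmax-all depth here (all-filter (_⪯? u) (allFin n))

  deepestBelow-isLeaf : ∀ u → IsLeafVertex (raw T) (deepestBelow u)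
  deepestBelow-isLeaf u c child = <⇒≱ (≺⇒depth> (child⇒≺ child)) depth-c≤
    where
      c∈below : c ∈ filter (_⪯? u) (allFin n)
      c∈below = ∈-filter⁺ (_⪯? u) (∈-allFin c) (⪯-trans (proj₁ (child⇒≺ child)) (deepestBelow-⪯ u))
      depth-c≤ : depth c ≤ depth (deepestBelow u)
      depth-c≤ = lookup (f[xs]≤f[argmax] u (filter (_⪯? u) (allFin n))) c∈below

  Cluster-nonempty : ∀ u → ∃ (Cluster T u)
  Cluster-nonempty u with leaf-onto T (deepestBelow u) (deepestBelow-isLeaf u)
  ... | x , leaf≡ = x , subst (_⪯ u) (sym leaf≡) (deepestBelow-⪯ u)

  child-on-path : ∀ {u v} → u ⪯ v → u ≢ v → ∃ λ c → Child (raw T) v c × u ⪯ c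
  child-on-path here u≢v = ⊥-elim (u≢v refl)
  child-on-path {u} {v} (up h p) _ with parent (raw T) u ≟ v
  ... | yes parent≡v = u , (h , parent≡v) , here
  ... | no  parent≢v with child-on-path p parent≢v
  ...   | c , child , q = c , child , up h q

  children-⪯⇒≡ : ∀ {v c c′} → Child (raw T) v c → Child (raw T) v c′ → c ⪯ c′ → c ≡ c′
  children-⪯⇒≡ _ _ here = refl
  children-⪯⇒≡ (_ , parent≡v) child′ (up _ p) =
    ⊥-elim (proj₂ (child⇒≺ child′) (⪯-antisym (proj₁ (child⇒≺ child′)) (subst (_⪯ _) parent≡v p)))

  siblings-disjoint : ∀ {v c c′ x} → Child (raw T) v c → Child (raw T) v c′ → c′ ≢ c
                    → x ⪯ c′ → ¬ x ⪯ c
  siblings-disjoint child child′ c′≢c x⪯c′ x⪯c with ⪯-total-above x⪯c x⪯c′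
  ... | inj₁ c⪯c′ = c′≢c (sym (children-⪯⇒≡ child child′ c⪯c′))
  ... | inj₂ c′⪯c = c′≢c (children-⪯⇒≡ child′ child c′⪯c)

  -- The phylogenetic condition enters here: the child of v towards u has a
  -- sibling, whose leaves lie in L(T(v)) but not in L(T(u)).
  ≺⇒Cluster-⊊ : ∀ {u v} → u ≺ v → Cluster T u ⊊ Cluster T v
  ≺⇒Cluster-⊊ {u} {v} u≺v with child-on-path (proj₁ u≺v) (proj₂ u≺v)
  ... | c , child , u⪯c with phylo T v c child
  ...   | c′ , child′ , c′≢c with Cluster-nonempty c′
  ...     | y , y⪯c′ =
    (λ x x⪯u → ⪯-trans x⪯u (proj₁ u≺v)) , y , ⪯-trans y⪯c′ (proj₁ (child⇒≺ child′)) ,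
    λ y⪯u → siblings-disjoint child child′ c′≢c y⪯c′ (⪯-trans y⪯u u⪯c)

  Cluster-⊆⇒⪯ : ∀ {u v} → Cluster T u ⊆ Cluster T v → u ⪯ v
  Cluster-⊆⇒⪯ {u} {v} u⊆v with Cluster-nonempty u
  ... | x , x⪯u with ⪯-total-above x⪯u (u⊆v x x⪯u)
  ...   | inj₁ u⪯v = u⪯v
  ...   | inj₂ v⪯u with v ≟ u
  ...     | yes refl = here
  ...     | no  v≢u with ≺⇒Cluster-⊊ (v⪯u , v≢u)
  ...       | _ , y , y⪯u , ¬y⪯v = ⊥-elim (¬y⪯v (u⊆v y y⪯u))

  Cluster-⊊⇒≺ : ∀ {u v} → Cluster T u ⊊ Cluster T v → u ≺ v
  Cluster-⊊⇒≺ (u⊆v , y , y⪯v , ¬y⪯u) =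
    Cluster-⊆⇒⪯ u⊆v , λ { refl → ¬y⪯u y⪯v }

  Cluster-injective : ∀ {u v} → Cluster T u ≐ Cluster T v → u ≡ v
  Cluster-injective (u⊆v , v⊆u) = ⪯-antisym (Cluster-⊆⇒⪯ u⊆v) (Cluster-⊆⇒⪯ v⊆u)

  child-≺⇒⪯ : ∀ {u c z} → Child (raw T) u c → c ≺ z → u ⪯ z
  child-≺⇒⪯ _ (here , c≢z) = ⊥-elim (c≢z refl)
  child-≺⇒⪯ (_ , parent≡u) (up _ p , _) = subst (_⪯ _) parent≡u p

  child-⪯⇒≺ : ∀ {u c z} → Child (raw T) u c → u ⪯ z → c ≺ z
  child-⪯⇒≺ child u⪯z =
    ⪯-trans (proj₁ (child⇒≺ child)) u⪯z ,
    λ { refl → proj₂ (child⇒≺ child) (⪯-antisym (proj₁ (child⇒≺ child)) u⪯z) }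

  least-ancestor : {Q : Fin n → Set} → Decidable Q → ∀ {v w} → v ⪯ w → Q w
                 → ∃ λ z → v ⪯ z × Q z × (∀ z′ → v ⪯ z′ → Q z′ → z ⪯ z′)
  least-ancestor Q? {v} p Qw with Q? v
  ... | yes Qv = v , here , Qv , λ _ v⪯z′ _ → v⪯z′
  least-ancestor Q? here     Qw | no ¬Qv = ⊥-elim (¬Qv Qw)
  least-ancestor Q? (up h p) Qw | no ¬Qv with least-ancestor Q? p Qw
  ... | z , p⪯z , Qz , least = z , up h p⪯z , Qz , least′
    where
      least′ : ∀ z′ → _ ⪯ z′ → _ → z ⪯ z′
      least′ _ here     Qz′ = ⊥-elim (¬Qv Qz′)
      least′ z′ (up _ q) Qz′ = least z′ q Qz′

module Refinement {X : Set} {n m : ℕ} (T : PhyloTree X n) (T* : PhyloTree X m)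
                  (refines : Refines T* T) (v* : Fin m) where

  private
    module H  = Tree T
    module H* = Tree T*

  copy : Fin n → Fin m
  copy z = proj₁ (refines z)

  Cluster-copy : ∀ z → Cluster T* (copy z) ≐ Cluster T z
  Cluster-copy z = proj₂ (refines z)

  Above : Fin n → Set
  Above z = Cluster T* v* ⊊ Cluster T z

  Above⇒≺copy : ∀ {z} → Above z → v* H*.≺ copy z
  Above⇒≺copy {z} above = H*.Cluster-⊊⇒≺ (⊊-respʳ-≐ above (swap (Cluster-copy z)))

  ≺copy⇒Above : ∀ {z} → v* H*.≺ copy z → Above z
  ≺copy⇒Above {z} v*≺z = ⊊-respʳ-≐ (H*.≺⇒Cluster-⊊ v*≺z) (Cluster-copy z)

  Above? : Decidable Above
  Above? z with (v* H*.⪯? copy z) ×-dec ¬? (v* ≟ copy z)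
  ... | yes v*≺z = yes (≺copy⇒Above v*≺z)
  ... | no  v*⊀z = no λ above → v*⊀z (Above⇒≺copy above)

  Above-root : ∀ {u*} → IsEdge T* u* v* → Above (root (raw T))
  Above-root edge with H*.≺⇒Cluster-⊊ (H*.child⇒≺ edge)
  ... | _ , y , _ , y∉v* = (λ x _ → toRoot T (leaf T x)) , y , toRoot T (leaf T y) , y∉v*

  least-Above : Above (root (raw T)) → ∃ λ w → Above w × (∀ z → Above z → w H.⪯ z)
  least-Above above-root with H*.Cluster-nonempty v*
  ... | a , a∈v* with H.least-ancestor Above? (toRoot T (leaf T a)) above-root
  ...   | w , _ , above-w , least = w , above-w , λ z above-z → least z (proj₁ above-z a a∈v*) above-z

lemma1 : {X : Set} {n m : ℕ} (T : PhyloTree X n) (T* : PhyloTree X m)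
    → Refines T* T
    → (u* v* : Fin m) → IsEdge T* u* v*
    → ∃ λ w → MinimalAbove T (Cluster T* v*) w
        × (∀ w′ → MinimalAbove T (Cluster T* v*) w′ → w′ ≡ w)
        × (∀ x y → IsLca T* (leaf T* x) (leaf T* y) u*
                 → IsLca T (leaf T x) (leaf T y) w)
lemma1 {n = n} T T* refines u* v* edge = w , minimal , unique , lca
  where
    open Refinement T T* refines v*
    open Tree T
    module H* = Tree T*
    w : Fin n
    w = proj₁ (least-Above (Above-root edge))
    above-w : Above w
    above-w = proj₁ (proj₂ (least-Above (Above-root edge)))
    least : ∀ z → Above z → w ⪯ z
    least = proj₂ (proj₂ (least-Above (Above-root edge)))
    minimal : MinimalAbove T (Cluster T* v*) w
    minimal = above-w , λ z above-z z⊆w → z⊆w , λ x x⪯w → ⪯-trans x⪯w (least z above-z)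
    unique : ∀ w′ → MinimalAbove T (Cluster T* v*) w′ → w′ ≡ w
    unique w′ (above-w′ , minimal′) =
      sym (Cluster-injective (minimal′ w above-w λ x x⪯w → ⪯-trans x⪯w (least w′ above-w′)))
    lca : ∀ x y → IsLca T* (leaf T* x) (leaf T* y) u* → IsLca T (leaf T x) (leaf T y) w
    lca x y (x⪯u* , y⪯u* , u*-least) = below-w x x⪯u* , below-w y y⪯u* , upper-bound
      where
        u*⪯w : u* H*.⪯ copy w
        u*⪯w = H*.child-≺⇒⪯ edge (Above⇒≺copy above-w)
        below-w : ∀ x → leaf T* x H*.⪯ u* → leaf T x ⪯ w
        below-w x x⪯u* = proj₁ (Cluster-copy w) x (H*.⪯-trans x⪯u* u*⪯w)
        upper-bound : ∀ z → leaf T x ⪯ z → leaf T y ⪯ z → w ⪯ z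
        upper-bound z x⪯z y⪯z = least z (≺copy⇒Above (H*.child-⪯⇒≺ edge
          (u*-least (copy z) (proj₂ (Cluster-copy z) x x⪯z) (proj₂ (Cluster-copy z) y y⪯z))))
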